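{- For every $n\ge1$, $s(n)>0$ if and only if there exist an integer $m\ge 2$ and nonnegative integers $t_2,\dots,t_m$ with $t_m\ge 1$ such that $$\prod_{i=2}^{m} i^{t_i} + \sum_{i=2}^{m} (i-1)t_i + 3 = p_n.$$ (For $m=2$ this reads $2^{t_2}+t_2+3=p_n$; for $m=3$, $2^{t_2}3^{t_3}+t_2+2t_3+3=p_n$; for $m=4$, $2^{t_2}3^{t_3}4^{t_4}+t_2+2t_3+3t_4+3=p_n$; and so on.)
   Context: $p_n$ denotes the $n$-th prime. For an integer $k\ge 3$, say that a positive integer $N$ is represented by $F_k$ if there are integers $1\le x_1\le\dots\le x_k$ with $N=x_1\cdots x_k+x_1+\dots+x_k$. Define $s(n)$ to be the smallest integer $k\ge 3$ such that $p_n+k-3$ is represented by $F_k$, and $s(n)=0$ if there is no such $k$. -}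

module Defs where

open import Data.Nat using (ℕ; zero; suc; _+_; _*_; _∸_; _^_; _≤_; _<_)
open import Data.Nat.Primality using (Prime; prime?)
open import Data.Fin using (Fin)
import Data.Fin as Fin
open import Data.Vec using (Vec; lookup; toList)
open import Data.List using (List; length; filter; upTo; map)
open import Data.Nat.ListAction using (sum; product)
open import Data.Product using (Σ; _×_; ∃)
open import Data.Sum using (_⊎_)
open import Relation.Nullary using (¬_)
open import Relation.Binary.PropositionalEquality using (_≡_)

IsNthPrime : ℕ → ℕ → Set
IsNthPrime n p = Prime p × length (filter prime? (upTo p)) ≡ n ∸ 1

RepF : ℕ → ℕ → Set
RepF k N = Σ (Vec ℕ k) λ x →
  (∀ (i : Fin k) → 1 ≤ lookup x i) ×
  (∀ (i j : Fin k) → i Fin.≤ j → lookup x i ≤ lookup x j) ×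
  N ≡ product (toList x) + sum (toList x)

-- IsS p v : v is the value s(n) where p = p_n, i.e. v is the least k ≥ 3 with
-- p + k - 3 represented by F_k, or v = 0 if there is no such k.
IsS : ℕ → ℕ → Set
IsS p v =
  (3 ≤ v × RepF v (p + v ∸ 3) × (∀ k → 3 ≤ k → k < v → ¬ RepF k (p + k ∸ 3)))
  ⊎ (v ≡ 0 × (∀ k → 3 ≤ k → ¬ RepF k (p + k ∸ 3)))

range2 : ℕ → List ℕ
range2 m = map (λ i → 2 + i) (upTo (m ∸ 1))

prodPow : ℕ → (ℕ → ℕ) → ℕ
prodPow m t = product (map (λ i → i ^ t i) (range2 m))

sumLin : ℕ → (ℕ → ℕ) → ℕ
sumLin m t = sum (map (λ i → (i ∸ 1) * t i) (range2 m))

{-# OPTIONS --safe #-}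
-- A representation x₁ ≤ … ≤ x_k is a multiset of k positive integers. If t_i of its
-- entries equal i (i ≥ 2) and the others equal 1, then
--   x₁ ⋯ x_k + x₁ + … + x_k = ∏ i^{t_i} + ∑ (i - 1) t_i + k,
-- so p + k - 3 is represented by F_k (k ≥ 3) exactly when p = ∏ i^{t_i} + ∑ (i - 1) t_i + 3;
-- conversely such exponents give a representation with 3 + ∑ t_i entries, three of them 1.
-- Trailing zero exponents can be dropped so that t_m ≥ 1, unless all of them vanish,
-- which would force p = 4.
module Submission where

open import Defs
open import Data.Nat using (ℕ; zero; suc; _+_; _*_; _∸_; _^_; _≤_; _<_; z≤n; s≤s; _≟_)
open import Data.Nat.Properties
open import Algebra.Properties.CommutativeSemigroup *-commutativeSemigroup using (x∙yz≈y∙xz)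
open import Data.Nat.Primality using (Prime; composite⇒¬prime; composite[4])
open import Data.Nat.ListAction using (sum; product)
open import Data.Nat.ListAction.Properties using (sum-++; product-++; sum-↭; product-↭)
open import Data.Nat.Tactic.RingSolver using (solve-∀)
open import Data.List using (List; []; _∷_; _++_; [_]; replicate; length; map; upTo; concatMap)
import Data.List as List
open import Data.List.Properties using (length-++; length-replicate; map-++; upTo-∷ʳ)
open import Data.List.Relation.Unary.All using (All; []; _∷_)
import Data.List.Relation.Unary.All as All
import Data.List.Relation.Unary.All.Properties as All
open import Data.List.Relation.Binary.Permutation.Propositional using (↭-sym)
open import Data.List.Relation.Binary.Permutation.Propositional.Properties using (All-resp-↭; ↭-length)
open import Data.List.Relation.Unary.Sorted.TotalOrder ≤-totalOrder using (Sorted)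
open import Data.List.Relation.Unary.Sorted.TotalOrder.Properties using (lookup-mono-≤)
import Data.List.Sort ≤-decTotalOrder as Sort
open import Data.Vec using (fromList; toList)
import Data.Vec as Vec
open import Data.Vec.Properties using (toList∘fromList; length-toList)
import Data.Vec.Relation.Unary.All.Properties as VecAll
open import Data.Fin using (Fin)
open import Data.Product using (Σ; _×_; _,_)
open import Data.Sum using (_⊎_; inj₁; inj₂)
import Data.Sum as Sum
open import Data.Empty using (⊥-elim)
open import Relation.Nullary using (yes; no)
open import Relation.Binary.PropositionalEquality using (_≡_; _≢_; refl; sym; trans; cong; cong₂; subst; subst₂; module ≡-Reasoning)
open import Function.Base using (_∘_)
open import Function.Bundles using (_⇔_; mk⇔)

open ≡-Reasoning

lookup-fromList : ∀ {a} {A : Set a} (xs : List A) (i : Fin (length xs)) →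
  Vec.lookup (fromList xs) i ≡ List.lookup xs i
lookup-fromList (x ∷ xs) Fin.zero    = refl
lookup-fromList (x ∷ xs) (Fin.suc i) = lookup-fromList xs i

All-≤-sum : ∀ xs → All (_≤ sum xs) xs
All-≤-sum []       = []
All-≤-sum (x ∷ xs) = m≤m+n x (sum xs) ∷ All.map (λ x≤ → ≤-trans x≤ (m≤n+m (sum xs) x)) (All-≤-sum xs)

product-replicate : ∀ c b → product (replicate c b) ≡ b ^ c
product-replicate zero    b = refl
product-replicate (suc c) b = cong (b *_) (product-replicate c b)

sum-replicate : ∀ c b → sum (replicate c b) ≡ c * b
sum-replicate zero    b = refl
sum-replicate (suc c) b = cong (b +_) (sum-replicate c b)

RepF⇒list : ∀ {k N} → RepF k N →
  Σ (List ℕ) λ xs → length xs ≡ k × All (1 ≤_) xs × N ≡ product xs + sum xs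
RepF⇒list (x , positive , _ , N≡) =
  toList x , length-toList x , VecAll.toList⁺ (VecAll.lookup⁻ positive) , N≡

sorted⇒RepF : ∀ {xs} → Sorted xs → All (1 ≤_) xs → RepF (length xs) (product xs + sum xs)
sorted⇒RepF {xs} xs↗ positive =
  fromList xs ,
  VecAll.lookup⁺ (VecAll.fromList⁺ positive) ,
  (λ i j i≤j → subst₂ _≤_ (sym (lookup-fromList xs i)) (sym (lookup-fromList xs j))
                 (lookup-mono-≤ ≤-totalOrder xs↗ i≤j)) ,
  cong (λ ys → product ys + sum ys) (sym (toList∘fromList xs))

list⇒RepF : ∀ {xs} → All (1 ≤_) xs → RepF (length xs) (product xs + sum xs)
list⇒RepF {xs} positive
  rewrite sym (↭-length (Sort.sort-↭ xs))
        | sym (product-↭ (Sort.sort-↭ xs))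
        | sym (sum-↭ (Sort.sort-↭ xs))
  = sorted⇒RepF (Sort.sort-↗ xs) (All-resp-↭ (↭-sym (Sort.sort-↭ xs)) positive)

replicateEach : (ℕ → ℕ) → List ℕ → List ℕ
replicateEach t = concatMap (λ i → replicate (t i) i)

All-replicateEach : ∀ {P : ℕ → Set} t {is} → All P is → All P (replicateEach t is)
All-replicateEach t []         = []
All-replicateEach t (pi ∷ pis) = All.++⁺ (All.replicate⁺ (t _) pi) (All-replicateEach t pis)

product-replicateEach : ∀ t is → product (replicateEach t is) ≡ product (map (λ i → i ^ t i) is)
product-replicateEach t []       = refl
product-replicateEach t (i ∷ is) =
  trans (product-++ (replicate (t i) i) (replicateEach t is))
        (cong₂ _*_ (product-replicate (t i) i) (product-replicateEach t is))

sum-replicateEach : ∀ t {is} → All (1 ≤_) is →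
  sum (replicateEach t is) ≡ sum (map (λ i → (i ∸ 1) * t i) is) + length (replicateEach t is)
sum-replicateEach t {[]}     []                = refl
sum-replicateEach t {i ∷ is} (s≤s {n = j} _ ∷ pis) = begin
  sum (block ++ rest)                         ≡⟨ sum-++ block rest ⟩
  sum block + sum rest                        ≡⟨ cong₂ _+_ (sum-replicate c i) (sum-replicateEach t pis) ⟩
  c * i + (S + length rest)                   ≡⟨ regroup c j S (length rest) ⟩
  j * c + S + (c + length rest)               ≡⟨ cong (j * c + S +_) (cong (_+ length rest) (sym (length-replicate c))) ⟩
  j * c + S + (length block + length rest)    ≡⟨ cong (j * c + S +_) (sym (length-++ block)) ⟩
  j * c + S + length (block ++ rest)          ∎
  where
  c : ℕ
  c = t i
  block rest : List ℕ
  block = replicate c i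
  rest = replicateEach t is
  S : ℕ
  S = sum (map (λ i → (i ∸ 1) * t i) is)
  regroup : ∀ c j S L → c * suc j + (S + L) ≡ j * c + S + (c + L)
  regroup = solve-∀

range2-positive : ∀ m → All (1 ≤_) (range2 m)
range2-positive m = All.map⁺ (All.universal (λ _ → s≤s z≤n) (upTo (m ∸ 1)))

-- Witnessed by j ones together with t i copies of each i = 2, …, m.
exponents⇒RepF : ∀ j m t → let e = length (replicateEach t (range2 m)) in
  RepF (j + e) (prodPow m t + sumLin m t + (j + e))
exponents⇒RepF j m t =
  subst₂ RepF size value
    (list⇒RepF (All.++⁺ (All.replicate⁺ j ≤-refl) (All-replicateEach t (range2-positive m))))
  where
  ones E : List ℕ
  ones = replicate j 1
  E = replicateEach t (range2 m)
  size : length (ones ++ E) ≡ j + length E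
  size = trans (length-++ ones) (cong (_+ length E) (length-replicate j))
  value : product (ones ++ E) + sum (ones ++ E) ≡ prodPow m t + sumLin m t + (j + length E)
  value = begin
    product (ones ++ E) + sum (ones ++ E)
      ≡⟨ cong₂ _+_ (product-++ ones E) (sum-++ ones E) ⟩
    product ones * product E + (sum ones + sum E)
      ≡⟨ cong₂ (λ a b → a * product E + (b + sum E)) (trans (product-replicate j 1) (^-zeroˡ j)) (sum-replicate j 1) ⟩
    1 * product E + (j * 1 + sum E)
      ≡⟨ cong₂ (λ a b → 1 * a + (j * 1 + b)) (product-replicateEach t (range2 m)) (sum-replicateEach t (range2-positive m)) ⟩
    1 * prodPow m t + (j * 1 + (sumLin m t + length E))
      ≡⟨ regroup (prodPow m t) (sumLin m t) j (length E) ⟩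
    prodPow m t + sumLin m t + (j + length E) ∎
    where
    regroup : ∀ P S j e → 1 * P + (j * 1 + (S + e)) ≡ P + S + (j + e)
    regroup = solve-∀

map-range2-suc : ∀ (g : ℕ → ℕ) n → map g (range2 (2 + n)) ≡ map g (range2 (1 + n)) ++ [ g (2 + n) ]
map-range2-suc g n = begin
  map g (map (2 +_) (upTo (suc n)))              ≡⟨ cong (map g ∘ map (2 +_)) (upTo-∷ʳ n) ⟨
  map g (map (2 +_) (upTo n ++ [ n ]))           ≡⟨ cong (map g) (map-++ (2 +_) (upTo n) [ n ]) ⟩
  map g (map (2 +_) (upTo n) ++ [ 2 + n ])       ≡⟨ map-++ g (map (2 +_) (upTo n)) [ 2 + n ] ⟩
  map g (range2 (1 + n)) ++ [ g (2 + n) ]        ∎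

prodPow-suc : ∀ n t → prodPow (2 + n) t ≡ prodPow (1 + n) t * (2 + n) ^ t (2 + n)
prodPow-suc n t = begin
  product (map g (range2 (2 + n)))                    ≡⟨ cong product (map-range2-suc g n) ⟩
  product (map g (range2 (1 + n)) ++ [ g (2 + n) ])   ≡⟨ product-++ (map g (range2 (1 + n))) _ ⟩
  prodPow (1 + n) t * (g (2 + n) * 1)                 ≡⟨ cong (prodPow (1 + n) t *_) (*-identityʳ _) ⟩
  prodPow (1 + n) t * g (2 + n)                       ∎
  where
  g : ℕ → ℕ
  g i = i ^ t i

sumLin-suc : ∀ n t → sumLin (2 + n) t ≡ sumLin (1 + n) t + (1 + n) * t (2 + n)
sumLin-suc n t = begin
  sum (map g (range2 (2 + n)))                    ≡⟨ cong sum (map-range2-suc g n) ⟩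
  sum (map g (range2 (1 + n)) ++ [ g (2 + n) ])   ≡⟨ sum-++ (map g (range2 (1 + n))) _ ⟩
  sumLin (1 + n) t + (g (2 + n) + 0)              ≡⟨ cong (sumLin (1 + n) t +_) (+-identityʳ _) ⟩
  sumLin (1 + n) t + g (2 + n)                    ∎
  where
  g : ℕ → ℕ
  g i = (i ∸ 1) * t i

prodPow-cong : ∀ m {t u} → (∀ i → i ≤ m → t i ≡ u i) → prodPow m t ≡ prodPow m u
prodPow-cong zero          t≗u = refl
prodPow-cong (suc zero)    t≗u = refl
prodPow-cong (suc (suc n)) {t} {u} t≗u = begin
  prodPow (2 + n) t                        ≡⟨ prodPow-suc n t ⟩
  prodPow (1 + n) t * (2 + n) ^ t (2 + n)  ≡⟨ cong₂ _*_ (prodPow-cong (suc n) (λ i i≤ → t≗u i (m≤n⇒m≤1+n i≤)))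
                                                        (cong ((2 + n) ^_) (t≗u (2 + n) ≤-refl)) ⟩
  prodPow (1 + n) u * (2 + n) ^ u (2 + n)  ≡⟨ prodPow-suc n u ⟨
  prodPow (2 + n) u                        ∎

sumLin-cong : ∀ m {t u} → (∀ i → i ≤ m → t i ≡ u i) → sumLin m t ≡ sumLin m u
sumLin-cong zero          t≗u = refl
sumLin-cong (suc zero)    t≗u = refl
sumLin-cong (suc (suc n)) {t} {u} t≗u = begin
  sumLin (2 + n) t                         ≡⟨ sumLin-suc n t ⟩
  sumLin (1 + n) t + (1 + n) * t (2 + n)   ≡⟨ cong₂ _+_ (sumLin-cong (suc n) (λ i i≤ → t≗u i (m≤n⇒m≤1+n i≤)))
                                                        (cong ((1 + n) *_) (t≗u (2 + n) ≤-refl)) ⟩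
  sumLin (1 + n) u + (1 + n) * u (2 + n)   ≡⟨ sumLin-suc n u ⟨
  sumLin (2 + n) u                         ∎

incrementAt : ℕ → (ℕ → ℕ) → ℕ → ℕ
incrementAt y t i with i ≟ y
... | yes _ = suc (t i)
... | no  _ = t i

incrementAt-≡ : ∀ y t → incrementAt y t y ≡ suc (t y)
incrementAt-≡ y t with y ≟ y
... | yes _   = refl
... | no  y≢y = ⊥-elim (y≢y refl)

incrementAt-≢ : ∀ {y i} t → i ≢ y → incrementAt y t i ≡ t i
incrementAt-≢ {y} {i} t i≢y with i ≟ y
... | yes i≡y = ⊥-elim (i≢y i≡y)
... | no  _   = refl

incrementAt-below : ∀ {y i} t → i < y → incrementAt y t i ≡ t i
incrementAt-below t i<y = incrementAt-≢ t (<⇒≢ i<y)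

prodPow-incrementAt : ∀ n {y} t → 2 ≤ y → y ≤ suc n →
  prodPow (suc n) (incrementAt y t) ≡ y * prodPow (suc n) t
prodPow-incrementAt zero    t (s≤s (s≤s _)) (s≤s ())
prodPow-incrementAt (suc n) {y} t 2≤y y≤2+n with m≤n⇒m<n∨m≡n y≤2+n
... | inj₂ refl = begin
  prodPow (2 + n) (incrementAt y t)                        ≡⟨ prodPow-suc n (incrementAt y t) ⟩
  prodPow (1 + n) (incrementAt y t) * y ^ incrementAt y t y ≡⟨ cong₂ _*_ (prodPow-cong (suc n) (λ i i≤ → incrementAt-below t (s≤s i≤)))
                                                                         (cong (y ^_) (incrementAt-≡ y t)) ⟩
  prodPow (1 + n) t * (y * y ^ t y)                        ≡⟨ x∙yz≈y∙xz (prodPow (1 + n) t) y _ ⟩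
  y * (prodPow (1 + n) t * y ^ t y)                        ≡⟨ cong (y *_) (prodPow-suc n t) ⟨
  y * prodPow (2 + n) t                                    ∎
... | inj₁ y<2+n = begin
  prodPow (2 + n) (incrementAt y t)                                  ≡⟨ prodPow-suc n (incrementAt y t) ⟩
  prodPow (1 + n) (incrementAt y t) * (2 + n) ^ incrementAt y t (2 + n)
    ≡⟨ cong₂ _*_ (prodPow-incrementAt n t 2≤y (≤-pred y<2+n))
                 (cong ((2 + n) ^_) (incrementAt-≢ t (>⇒≢ y<2+n))) ⟩
  y * prodPow (1 + n) t * (2 + n) ^ t (2 + n)                        ≡⟨ *-assoc y _ _ ⟩
  y * (prodPow (1 + n) t * (2 + n) ^ t (2 + n))                      ≡⟨ cong (y *_) (prodPow-suc n t) ⟨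
  y * prodPow (2 + n) t                                              ∎

sumLin-incrementAt : ∀ n {y} t → 2 ≤ y → y ≤ suc n →
  sumLin (suc n) (incrementAt y t) ≡ (y ∸ 1) + sumLin (suc n) t
sumLin-incrementAt zero    t (s≤s (s≤s _)) (s≤s ())
sumLin-incrementAt (suc n) {y} t 2≤y y≤2+n with m≤n⇒m<n∨m≡n y≤2+n
... | inj₂ refl = begin
  sumLin (2 + n) (incrementAt y t)                          ≡⟨ sumLin-suc n (incrementAt y t) ⟩
  sumLin (1 + n) (incrementAt y t) + (1 + n) * incrementAt y t y
    ≡⟨ cong₂ _+_ (sumLin-cong (suc n) (λ i i≤ → incrementAt-below t (s≤s i≤)))
                 (cong ((1 + n) *_) (incrementAt-≡ y t)) ⟩
  sumLin (1 + n) t + (1 + n) * suc (t y)                    ≡⟨ regroup (sumLin (1 + n) t) (1 + n) (t y) ⟩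
  (1 + n) + (sumLin (1 + n) t + (1 + n) * t y)              ≡⟨ cong ((1 + n) +_) (sumLin-suc n t) ⟨
  (1 + n) + sumLin (2 + n) t                                ∎
  where
  regroup : ∀ S k c → S + k * suc c ≡ k + (S + k * c)
  regroup = solve-∀
... | inj₁ y<2+n = begin
  sumLin (2 + n) (incrementAt y t)                                   ≡⟨ sumLin-suc n (incrementAt y t) ⟩
  sumLin (1 + n) (incrementAt y t) + (1 + n) * incrementAt y t (2 + n)
    ≡⟨ cong₂ _+_ (sumLin-incrementAt n t 2≤y (≤-pred y<2+n))
                 (cong ((1 + n) *_) (incrementAt-≢ t (>⇒≢ y<2+n))) ⟩
  (y ∸ 1) + sumLin (1 + n) t + (1 + n) * t (2 + n)                   ≡⟨ +-assoc (y ∸ 1) _ _ ⟩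
  (y ∸ 1) + (sumLin (1 + n) t + (1 + n) * t (2 + n))                 ≡⟨ cong ((y ∸ 1) +_) (sumLin-suc n t) ⟨
  (y ∸ 1) + sumLin (2 + n) t                                         ∎

prodPow-zero : ∀ m → prodPow m (λ _ → 0) ≡ 1
prodPow-zero zero          = refl
prodPow-zero (suc zero)    = refl
prodPow-zero (suc (suc n)) = trans (prodPow-suc n (λ _ → 0)) (cong (_* 1) (prodPow-zero (suc n)))

sumLin-zero : ∀ m → sumLin m (λ _ → 0) ≡ 0
sumLin-zero zero          = refl
sumLin-zero (suc zero)    = refl
sumLin-zero (suc (suc n)) =
  trans (sumLin-suc n (λ _ → 0)) (cong₂ _+_ (sumLin-zero (suc n)) (*-zeroʳ (1 + n)))

multiplicities : ∀ n xs → All (λ x → 1 ≤ x × x ≤ suc n) xs →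
  Σ (ℕ → ℕ) λ t → prodPow (suc n) t ≡ product xs × sumLin (suc n) t + length xs ≡ sum xs
multiplicities n [] [] = (λ _ → 0) , prodPow-zero (suc n) , trans (+-identityʳ _) (sumLin-zero (suc n))
multiplicities n (x ∷ xs) (_ ∷ bounds) with multiplicities n xs bounds
multiplicities n (suc zero ∷ xs) _ | t , P≡ , S≡ =
  t , trans P≡ (sym (*-identityˡ _)) , trans (+-suc _ _) (cong suc S≡)
multiplicities n (x@(suc (suc _)) ∷ xs) ((_ , x≤1+n) ∷ _) | t , P≡ , S≡ =
  incrementAt x t ,
  trans (prodPow-incrementAt n t (s≤s (s≤s z≤n)) x≤1+n) (cong (x *_) P≡) ,
  (begin
    sumLin (suc n) (incrementAt x t) + suc (length xs)   ≡⟨ cong (_+ suc (length xs)) (sumLin-incrementAt n t (s≤s (s≤s z≤n)) x≤1+n) ⟩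
    (x ∸ 1) + sumLin (suc n) t + suc (length xs)          ≡⟨ regroup (x ∸ 1) (sumLin (suc n) t) (length xs) ⟩
    suc (x ∸ 1) + (sumLin (suc n) t + length xs)          ≡⟨ cong (x +_) S≡ ⟩
    x + sum xs                                            ∎)
  where
  regroup : ∀ a b c → a + b + suc c ≡ suc a + (b + c)
  regroup = solve-∀

lastPositiveExponent : ∀ n t →
  (prodPow (suc n) t ≡ 1 × sumLin (suc n) t ≡ 0) ⊎
  Σ ℕ λ m → 2 ≤ m × 1 ≤ t m × prodPow m t ≡ prodPow (suc n) t × sumLin m t ≡ sumLin (suc n) t
lastPositiveExponent zero    t = inj₁ (refl , refl)
lastPositiveExponent (suc n) t with t (2 + n) in tₘ≡
... | suc _ = inj₂ (2 + n , s≤s (s≤s z≤n) , subst (1 ≤_) (sym tₘ≡) (s≤s z≤n) , refl , refl)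
... | zero  = Sum.map (λ (P≡1 , S≡0) → trans (sym P≡) P≡1 , trans (sym S≡) S≡0)
                      (λ (m , 2≤m , 1≤tₘ , P≡′ , S≡′) → m , 2≤m , 1≤tₘ , trans P≡′ P≡ , trans S≡′ S≡)
                      (lastPositiveExponent n t)
  where
  P≡ : prodPow (1 + n) t ≡ prodPow (2 + n) t
  P≡ = sym (trans (prodPow-suc n t) (trans (cong (λ c → prodPow (1 + n) t * (2 + n) ^ c) tₘ≡) (*-identityʳ _)))
  S≡ : sumLin (1 + n) t ≡ sumLin (2 + n) t
  S≡ = sym (trans (sumLin-suc n t) (trans (cong (λ c → sumLin (1 + n) t + (1 + n) * c) tₘ≡)
                                           (trans (cong (sumLin (1 + n) t +_) (*-zeroʳ (1 + n))) (+-identityʳ _))))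

RepF⇒exponents : ∀ {k N} → RepF k N →
  Σ ℕ λ n → Σ (ℕ → ℕ) λ t → prodPow (suc n) t + sumLin (suc n) t + k ≡ N
RepF⇒exponents {k} {N} rep with RepF⇒list rep
... | xs , length≡k , positive , N≡
    with multiplicities (sum xs) xs (All.zipWith (λ (1≤x , x≤sum) → 1≤x , m≤n⇒m≤1+n x≤sum) (positive , All-≤-sum xs))
... | t , P≡ , S≡ = sum xs , t , (begin
  prodPow m t + sumLin m t + k              ≡⟨ cong (prodPow m t + sumLin m t +_) length≡k ⟨
  prodPow m t + sumLin m t + length xs      ≡⟨ +-assoc (prodPow m t) _ _ ⟩
  prodPow m t + (sumLin m t + length xs)    ≡⟨ cong₂ _+_ P≡ S≡ ⟩
  product xs + sum xs                       ≡⟨ N≡ ⟨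
  N                                         ∎)
  where
  m : ℕ
  m = suc (sum xs)

p+[3+w]∸3≡p+w : ∀ p w → p + (3 + w) ∸ 3 ≡ p + w
p+[3+w]∸3≡p+w p w = +-∸-assoc p (m≤m+n 3 w)

shiftedRep⇒exponents : ∀ {p k} → 3 ≤ k → RepF k (p + k ∸ 3) →
  Σ ℕ λ n → Σ (ℕ → ℕ) λ t → prodPow (suc n) t + sumLin (suc n) t + 3 ≡ p
shiftedRep⇒exponents {p} (s≤s (s≤s (s≤s {n = w} _))) rep with RepF⇒exponents rep
... | n , t , value≡ =
  n , t , +-cancelʳ-≡ w _ _ (trans (+-assoc _ 3 w) (trans value≡ (p+[3+w]∸3≡p+w p w)))

exponents⇒shiftedRep : ∀ {p} m t → prodPow m t + sumLin m t + 3 ≡ p →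
  Σ ℕ λ k → 3 ≤ k × RepF k (p + k ∸ 3)
exponents⇒shiftedRep {p} m t value≡ =
  3 + e , s≤s (s≤s (s≤s z≤n)) , subst (RepF (3 + e)) shifted (exponents⇒RepF 3 m t)
  where
  e : ℕ
  e = length (replicateEach t (range2 m))
  shifted : prodPow m t + sumLin m t + (3 + e) ≡ p + (3 + e) ∸ 3
  shifted = trans (sym (+-assoc _ 3 e)) (trans (cong (_+ e) value≡) (sym (p+[3+w]∸3≡p+w p e)))

proposition5 : (n : ℕ) → 1 ≤ n → (p : ℕ) → IsNthPrime n p → (v : ℕ) → IsS p v →
    (0 < v ⇔ Σ ℕ λ m → Σ (ℕ → ℕ) λ t →
      2 ≤ m × 1 ≤ t m × prodPow m t + sumLin m t + 3 ≡ p)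
proposition5 _ _ p (p-prime , _) v isS = mk⇔ (to isS) (from isS)
  where
  Exponents : Set
  Exponents = Σ ℕ λ m → Σ (ℕ → ℕ) λ t → 2 ≤ m × 1 ≤ t m × prodPow m t + sumLin m t + 3 ≡ p

  to : IsS p v → 0 < v → Exponents
  to (inj₂ (refl , _)) ()
  to (inj₁ (3≤v , rep , _)) _ with shiftedRep⇒exponents 3≤v rep
  ... | n , t , value≡ with lastPositiveExponent n t
  ...   | inj₁ (P≡1 , S≡0) =
    ⊥-elim (composite⇒¬prime composite[4] (subst Prime (trans (sym value≡) (cong₂ (λ a b → a + b + 3) P≡1 S≡0)) p-prime))
  ...   | inj₂ (m , 2≤m , 1≤tₘ , P≡ , S≡) =
    m , t , 2≤m , 1≤tₘ , trans (cong₂ (λ a b → a + b + 3) P≡ S≡) value≡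

  from : IsS p v → Exponents → 0 < v
  from (inj₁ (3≤v , _)) _ = ≤-trans (s≤s z≤n) 3≤v
  from (inj₂ (_ , none)) (m , t , _ , _ , value≡) with exponents⇒shiftedRep m t value≡
  ... | k , 3≤k , rep = ⊥-elim (none k 3≤k rep)
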